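{- Let $p$ be an odd prime and let $n>2$ be an integer with $n\equiv 2\pmod 4$. Then the polynomial $$f_{n,0}(x)=2\sum_{j\geq 0}\binom{n}{2j}x^j\in\mathbb{F}_p[x]$$ is not an irreducible self-reciprocal polynomial over $\mathbb{F}_p$.
   Context: Binomial coefficients $\binom{a}{b}$ are $0$ when $b>a$; coefficients are reduced modulo $p$. A nonzero polynomial $f$ of degree $d$ is self-reciprocal if $x^d f(1/x)=f(x)$. -}

module Defs where

open import Data.Nat using (ℕ; zero; suc; _+_; _*_; _∸_; _<_; _≤_; ∣_-_∣; _/_)
open import Data.Nat.Divisibility using (_∣_)
open import Data.Nat.Combinatorics using (_C_)
open import Data.List using (List; []; _∷_; map; upTo)
open import Data.Product using (_×_; ∃)
open import Data.Sum using (_⊎_)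
open import Relation.Nullary using (¬_)

-- Polynomials over F_p are represented by coefficient lists of naturals
-- (lowest degree first), read modulo p.  Trailing (mod-p) zeros are allowed;
-- all notions below are invariant under them.
Poly : Set
Poly = List ℕ

coeff : Poly → ℕ → ℕ
coeff []       _       = 0
coeff (a ∷ f)  zero    = a
coeff (a ∷ f)  (suc i) = coeff f i

_≡_[mod_] : ℕ → ℕ → ℕ → Set
a ≡ b [mod p ] = p ∣ ∣ a - b ∣

-- polynomial addition and multiplication (over ℕ; reduction mod p commutes)
addP : Poly → Poly → Poly
addP []      g       = g
addP f       []      = f
addP (a ∷ f) (b ∷ g) = (a + b) ∷ addP f g

mulP : Poly → Poly → Poly
mulP []      g = []
mulP (a ∷ f) g = addP (map (a *_) g) (0 ∷ mulP f g)

_≈_[modP_] : Poly → Poly → ℕ → Set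
f ≈ g [modP p ] = ∀ i → coeff f i ≡ coeff g i [mod p ]

HasDegree : ℕ → Poly → ℕ → Set
HasDegree p f d = (¬ (coeff f d ≡ 0 [mod p ])) × (∀ i → d < i → coeff f i ≡ 0 [mod p ])

IsUnit : ℕ → Poly → Set
IsUnit p g = ∃ λ u → mulP g u ≈ (1 ∷ []) [modP p ]

Irreducible : ℕ → Poly → Set
Irreducible p f =
  (¬ (f ≈ [] [modP p ])) × (¬ IsUnit p f) ×
  (∀ g h → f ≈ mulP g h [modP p ] → IsUnit p g ⊎ IsUnit p h)

-- self-reciprocal: nonzero of degree d with x^d f(1/x) = f(x), i.e.
-- coefficient i equals coefficient d - i for i ≤ d (higher ones vanish on both sides)
SelfReciprocal : ℕ → Poly → Set
SelfReciprocal p f = ∃ λ d → HasDegree p f d ×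
  (∀ i → i ≤ d → coeff f (d ∸ i) ≡ coeff f i [mod p ])

-- f_{n,0}(x) = 2 Σ_{j ≥ 0} C(n,2j) x^j ; terms with 2j > n vanish,
-- so j ranges over 0 .. n suffices.
fn0 : ℕ → Poly
fn0 n = map (λ j → 2 * (n C (2 * j))) (upTo (suc n))

module Submission where

-- Since n ≡ 2 (mod 4), f_{n,0} has odd degree m = n/2, with leading coefficient 2 ≢ 0 in 𝔽ₚ.
-- A self-reciprocal polynomial of odd degree m vanishes at -1, its coefficients cancelling in
-- pairs c_i, c_{m-i}; so it is (1 + x) times a polynomial of degree m - 1 ≥ 2, and over a
-- field neither factor is a unit.

open import Defs
open import Data.Nat
  using ( ℕ; zero; suc; _+_; _*_; _∸_; _<_; _≤_; ∣_-_∣; pred; _%_; _/_; _<?_; z≤n; s≤s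
        ; NonZero; nonTrivial⇒n>1)
open import Data.Nat.Properties
  using ( ∣-∣-identityʳ; ∣n-n∣≡0; ∣-∣-comm; suc-pred; +-comm; +-suc; +-assoc; +-identityʳ
        ; *-identityˡ; *-zeroʳ; m+n∸n≡m; <-cmp; <-irrefl; ≤-refl; <⇒≤; ≤-trans; m≤n+m; m≤m+n
        ; ≮⇒≥; *-monoʳ-<; m≤n⇒m≤1+n; ≤-reflexive; ≤-pred; ≤-antisym)
open import Data.Nat.Divisibility using (_∣_; _∣0; _∣?_; ∣1⇒≡1; ∣⇒≤; m∣m*n)
open import Data.Nat.DivMod using (m≡m%n+[m/n]*n)
open import Data.Nat.Primality using (Prime; ¬prime[1]; prime⇒nonZero; prime⇒nonTrivial; euclidsLemma)
open import Data.Nat.Combinatorics using (_C_; nCn≡1; k>n⇒nCk≡0)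
import Data.Nat.Tactic.RingSolver as ℕ-Solver
open import Data.Integer as ℤ using (ℤ; +_; _⊖_)
open import Data.Integer.Properties using ([1+m]⊖[1+n]≡m⊖n; [+m]-[+n]≡m⊖n; pos-+; pos-*)
open import Data.Integer.Divisibility.Signed as ℤ∣
  using (∣ᵤ⇒∣; ∣⇒∣ᵤ; ∣m∣n⇒∣m+n; ∣n⇒∣m*n; ∣m⇒∣m*n)
open import Data.Integer.Tactic.RingSolver using (solve-∀)
open import Data.List using ([]; _∷_; map; applyUpTo; upTo)
open import Data.Product using (Σ; _×_; _,_; ∃; proj₁; proj₂)
open import Data.Sum using (_⊎_; inj₁; inj₂; [_,_])
open import Function using (_∘_; id)
open import Relation.Nullary using (¬_; yes; no; contradiction)
open import Relation.Binary.Definitions using (tri<; tri≈; tri>)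
open import Relation.Binary.Bundles using (Setoid)
open import Relation.Binary.PropositionalEquality
  using (_≡_; _≢_; refl; sym; trans; cong; cong₂; subst; module ≡-Reasoning)
import Relation.Binary.Reasoning.Setoid as SetoidReasoning

∣⊖∣≡∣-∣ : ∀ m n → ℤ.∣ m ⊖ n ∣ ≡ ∣ m - n ∣
∣⊖∣≡∣-∣ zero    zero    = refl
∣⊖∣≡∣-∣ zero    (suc n) = refl
∣⊖∣≡∣-∣ (suc m) zero    = refl
∣⊖∣≡∣-∣ (suc m) (suc n) = trans (cong ℤ.∣_∣ ([1+m]⊖[1+n]≡m⊖n m n)) (∣⊖∣≡∣-∣ m n)

infix 4 _≋_[mod_]

-- The congruence a ≡ b [mod p ] unfolds to p ∣ ∣ a - b ∣, from which Agda cannot recover a and b;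
-- wrapping it in a record makes them inferable.
record _≋_[mod_] (a b p : ℕ) : Set where
  constructor ⟦_⟧
  field ⌊_⌋ : a ≡ b [mod p ]
open _≋_[mod_] public

module _ {p : ℕ} where

  private
    ∣+a-+b∣ : ∀ a b → ℤ.∣ + a ℤ.- + b ∣ ≡ ∣ a - b ∣
    ∣+a-+b∣ a b = trans (cong ℤ.∣_∣ ([+m]-[+n]≡m⊖n a b)) (∣⊖∣≡∣-∣ a b)

  ≋⇒∣ℤ : ∀ {a b} → a ≋ b [mod p ] → + p ℤ∣.∣ + a ℤ.- + b
  ≋⇒∣ℤ {a} {b} ⟦ p∣ ⟧ = ∣ᵤ⇒∣ (subst (p ∣_) (sym (∣+a-+b∣ a b)) p∣)

  ∣ℤ⇒≋ : ∀ {a b z} → z ≡ + a ℤ.- + b → + p ℤ∣.∣ z → a ≋ b [mod p ]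
  ∣ℤ⇒≋ {a} {b} z≡a-b p∣z = ⟦ subst (p ∣_) (∣+a-+b∣ a b) (∣⇒∣ᵤ (subst (+ p ℤ∣.∣_) z≡a-b p∣z)) ⟧

  ≋-reflexive : ∀ {a b} → a ≡ b → a ≋ b [mod p ]
  ≋-reflexive {a} refl = ⟦ subst (p ∣_) (sym (∣n-n∣≡0 a)) (p ∣0) ⟧

  ≋-refl : ∀ {a} → a ≋ a [mod p ]
  ≋-refl = ≋-reflexive refl

  ≋-sym : ∀ {a b} → a ≋ b [mod p ] → b ≋ a [mod p ]
  ≋-sym {a} {b} ⟦ p∣ ⟧ = ⟦ subst (p ∣_) (∣-∣-comm a b) p∣ ⟧

  ≋-trans : ∀ {a b c} → a ≋ b [mod p ] → b ≋ c [mod p ] → a ≋ c [mod p ]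
  ≋-trans {a} {b} {c} a≋b b≋c =
    ∣ℤ⇒≋ (split (+ a) (+ b) (+ c)) (∣m∣n⇒∣m+n (≋⇒∣ℤ a≋b) (≋⇒∣ℤ b≋c))
    where
      split : ∀ x y z → (x ℤ.- y) ℤ.+ (y ℤ.- z) ≡ x ℤ.- z
      split = solve-∀

  +-cong-≋ : ∀ {a b c d} → a ≋ b [mod p ] → c ≋ d [mod p ] → a + c ≋ b + d [mod p ]
  +-cong-≋ {a} {b} {c} {d} a≋b c≋d = ∣ℤ⇒≋ diff (∣m∣n⇒∣m+n (≋⇒∣ℤ a≋b) (≋⇒∣ℤ c≋d))
    where
      split : ∀ x y z w → (x ℤ.- y) ℤ.+ (z ℤ.- w) ≡ (x ℤ.+ z) ℤ.- (y ℤ.+ w)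
      split = solve-∀
      diff : (+ a ℤ.- + b) ℤ.+ (+ c ℤ.- + d) ≡ + (a + c) ℤ.- + (b + d)
      diff = trans (split (+ a) (+ b) (+ c) (+ d)) (sym (cong₂ ℤ._-_ (pos-+ a c) (pos-+ b d)))

  *-cong-≋ : ∀ {a b c d} → a ≋ b [mod p ] → c ≋ d [mod p ] → a * c ≋ b * d [mod p ]
  *-cong-≋ {a} {b} {c} {d} a≋b c≋d =
    ∣ℤ⇒≋ diff (∣m∣n⇒∣m+n (∣n⇒∣m*n (+ a) (≋⇒∣ℤ c≋d)) (∣m⇒∣m*n (+ d) (≋⇒∣ℤ a≋b)))
    where
      split : ∀ x y z w → x ℤ.* (z ℤ.- w) ℤ.+ (x ℤ.- y) ℤ.* w ≡ x ℤ.* z ℤ.- y ℤ.* w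
      split = solve-∀
      diff : + a ℤ.* (+ c ℤ.- + d) ℤ.+ (+ a ℤ.- + b) ℤ.* + d ≡ + (a * c) ℤ.- + (b * d)
      diff = trans (split (+ a) (+ b) (+ c) (+ d)) (sym (cong₂ ℤ._-_ (pos-* a c) (pos-* b d)))

  +-cancelʳ-≋ : ∀ {a b c} → a + c ≋ b + c [mod p ] → a ≋ b [mod p ]
  +-cancelʳ-≋ {a} {b} {c} ac≋bc = ∣ℤ⇒≋ diff (≋⇒∣ℤ ac≋bc)
    where
      split : ∀ x y z → (x ℤ.+ z) ℤ.- (y ℤ.+ z) ≡ x ℤ.- y
      split = solve-∀
      diff : + (a + c) ℤ.- + (b + c) ≡ + a ℤ.- + b
      diff = trans (cong₂ ℤ._-_ (pos-+ a c) (pos-+ b c)) (split (+ a) (+ b) (+ c))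

  +-congˡ-≋ : ∀ a {b c} → b ≋ c [mod p ] → a + b ≋ a + c [mod p ]
  +-congˡ-≋ a = +-cong-≋ (≋-refl {a})

  +-congʳ-≋ : ∀ c {a b} → a ≋ b [mod p ] → a + c ≋ b + c [mod p ]
  +-congʳ-≋ c a≋b = +-cong-≋ a≋b (≋-refl {c})

  *-congˡ-≋ : ∀ a {b c} → b ≋ c [mod p ] → a * b ≋ a * c [mod p ]
  *-congˡ-≋ a = *-cong-≋ (≋-refl {a})

  *-congʳ-≋ : ∀ c {a b} → a ≋ b [mod p ] → a * c ≋ b * c [mod p ]
  *-congʳ-≋ c a≋b = *-cong-≋ a≋b (≋-refl {c})

  *-zeroʳ-≋ : ∀ a {b} → b ≋ 0 [mod p ] → a * b ≋ 0 [mod p ]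
  *-zeroʳ-≋ a b≋0 = ≋-trans (*-congˡ-≋ a b≋0) (≋-reflexive (*-zeroʳ a))

  ≋0⇒∣ : ∀ {a} → a ≋ 0 [mod p ] → p ∣ a
  ≋0⇒∣ {a} ⟦ p∣ ⟧ = subst (p ∣_) (∣-∣-identityʳ a) p∣

  ∣⇒≋0 : ∀ {a} → p ∣ a → a ≋ 0 [mod p ]
  ∣⇒≋0 {a} p∣a = ⟦ subst (p ∣_) (sym (∣-∣-identityʳ a)) p∣a ⟧

≋-setoid : ℕ → Setoid _ _
≋-setoid p = record
  { Carrier       = ℕ
  ; _≈_           = _≋_[mod p ]
  ; isEquivalence = record { refl = ≋-refl ; sym = ≋-sym ; trans = ≋-trans }
  }

neg : ℕ → ℕ → ℕ
neg p a = pred p * a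

+-neg-≋ : ∀ p .{{_ : NonZero p}} a → a + neg p a ≋ 0 [mod p ]
+-neg-≋ p a = ∣⇒≋0 (subst (λ q → p ∣ q * a) (sym (suc-pred p)) (m∣m*n a))

coeff-addP : ∀ f g i → coeff (addP f g) i ≡ coeff f i + coeff g i
coeff-addP []      g       i       = refl
coeff-addP (a ∷ f) []      i       = sym (+-identityʳ _)
coeff-addP (a ∷ f) (b ∷ g) zero    = refl
coeff-addP (a ∷ f) (b ∷ g) (suc i) = coeff-addP f g i

coeff-map-* : ∀ a g i → coeff (map (a *_) g) i ≡ a * coeff g i
coeff-map-* a []      i       = sym (*-zeroʳ a)
coeff-map-* a (b ∷ g) zero    = refl
coeff-map-* a (b ∷ g) (suc i) = coeff-map-* a g i

coeff-mulP-∷ : ∀ a f g i → coeff (mulP (a ∷ f) g) i ≡ a * coeff g i + coeff (0 ∷ mulP f g) i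
coeff-mulP-∷ a f g i =
  trans (coeff-addP (map (a *_) g) (0 ∷ mulP f g) i) (cong (_+ _) (coeff-map-* a g i))

coeff-map-applyUpTo-< : ∀ {A : Set} (g : A → ℕ) f {N i} → i < N →
                        coeff (map g (applyUpTo f N)) i ≡ g (f i)
coeff-map-applyUpTo-< g f {suc N} {zero}  _         = refl
coeff-map-applyUpTo-< g f {suc N} {suc i} (s≤s i<N) = coeff-map-applyUpTo-< g (f ∘ suc) i<N

coeff-map-applyUpTo-≥ : ∀ {A : Set} (g : A → ℕ) f {N i} → N ≤ i →
                        coeff (map g (applyUpTo f N)) i ≡ 0
coeff-map-applyUpTo-≥ g f {zero}  {i}     _         = refl
coeff-map-applyUpTo-≥ g f {suc N} {suc i} (s≤s N≤i) = coeff-map-applyUpTo-≥ g (f ∘ suc) N≤i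

DegreeAtMost : ℕ → Poly → ℕ → Set
DegreeAtMost p f d = ∀ i → d < i → coeff f i ≡ 0 [mod p ]

module _ {p : ℕ} where

  private
    coeff-mulP-∷-≋ : ∀ a f g i →
                     coeff (mulP (a ∷ f) g) i ≋ a * coeff g i + coeff (0 ∷ mulP f g) i [mod p ]
    coeff-mulP-∷-≋ a f g i = ≋-reflexive (coeff-mulP-∷ a f g i)

    coeff-0∷-≋0 : ∀ g → g ≈ [] [modP p ] → ∀ i → coeff (0 ∷ g) i ≋ 0 [mod p ]
    coeff-0∷-≋0 g g≈0 zero    = ≋-refl
    coeff-0∷-≋0 g g≈0 (suc i) = ⟦ g≈0 i ⟧

  mulP-zeroˡ : ∀ f u → f ≈ [] [modP p ] → mulP f u ≈ [] [modP p ]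
  mulP-zeroˡ []      u f≈0 i = ⌊ ≋-refl {a = 0} ⌋
  mulP-zeroˡ (a ∷ f) u f≈0 i = ⌊ begin
      coeff (mulP (a ∷ f) u) i                ≈⟨ coeff-mulP-∷-≋ a f u i ⟩
      a * coeff u i + coeff (0 ∷ mulP f u) i  ≈⟨ +-cong-≋ (*-congʳ-≋ (coeff u i) a≋0) tail≋0 ⟩
      0 * coeff u i + 0                       ∎ ⌋
    where
      open SetoidReasoning (≋-setoid p)
      a≋0 : a ≋ 0 [mod p ]
      a≋0 = ⟦ f≈0 0 ⟧
      tail≋0 : coeff (0 ∷ mulP f u) i ≋ 0 [mod p ]
      tail≋0 = coeff-0∷-≋0 (mulP f u) (mulP-zeroˡ f u (f≈0 ∘ suc)) i

  mulP-zeroʳ : ∀ f u → u ≈ [] [modP p ] → mulP f u ≈ [] [modP p ]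
  mulP-zeroʳ []      u u≈0 i = ⌊ ≋-refl {a = 0} ⌋
  mulP-zeroʳ (a ∷ f) u u≈0 i = ⌊ begin
      coeff (mulP (a ∷ f) u) i                ≈⟨ coeff-mulP-∷-≋ a f u i ⟩
      a * coeff u i + coeff (0 ∷ mulP f u) i  ≈⟨ +-cong-≋ (*-zeroʳ-≋ a u≋0) tail≋0 ⟩
      0 + 0                                   ∎ ⌋
    where
      open SetoidReasoning (≋-setoid p)
      u≋0 : coeff u i ≋ 0 [mod p ]
      u≋0 = ⟦ u≈0 i ⟧
      tail≋0 : coeff (0 ∷ mulP f u) i ≋ 0 [mod p ]
      tail≋0 = coeff-0∷-≋0 (mulP f u) (mulP-zeroʳ f u u≈0) i

  mulP-leading : ∀ f u {A B} → DegreeAtMost p f A → DegreeAtMost p u B →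
                 DegreeAtMost p (mulP f u) (A + B) ×
                 coeff (mulP f u) (A + B) ≋ coeff f A * coeff u B [mod p ]
  mulP-leading []      u         f≤A u≤B = (λ _ _ → ⌊ ≋-refl {a = 0} ⌋) , ≋-refl
  mulP-leading (a ∷ f) u {zero} {B} f≤0 u≤B = top , coeff≋ B
    where
      open SetoidReasoning (≋-setoid p)
      tail≈0 : mulP f u ≈ [] [modP p ]
      tail≈0 = mulP-zeroˡ f u (λ i → f≤0 (suc i) (s≤s z≤n))
      tail≋0 : ∀ i → coeff (0 ∷ mulP f u) i ≋ 0 [mod p ]
      tail≋0 = coeff-0∷-≋0 (mulP f u) tail≈0
      coeff≋ : ∀ i → coeff (mulP (a ∷ f) u) i ≋ a * coeff u i [mod p ]
      coeff≋ i = begin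
        coeff (mulP (a ∷ f) u) i                ≈⟨ coeff-mulP-∷-≋ a f u i ⟩
        a * coeff u i + coeff (0 ∷ mulP f u) i  ≈⟨ +-congˡ-≋ (a * coeff u i) (tail≋0 i) ⟩
        a * coeff u i + 0                       ≡⟨ +-identityʳ _ ⟩
        a * coeff u i                           ∎
      top : DegreeAtMost p (mulP (a ∷ f) u) B
      top i B<i = ⌊ ≋-trans (coeff≋ i) (*-zeroʳ-≋ a ⟦ u≤B i B<i ⟧) ⌋
  mulP-leading (a ∷ f) u {suc A} {B} f≤1+A u≤B = top , ≋-trans (shift (A + B) B<1+A+B) (proj₂ ih)
    where
      open SetoidReasoning (≋-setoid p)
      ih : DegreeAtMost p (mulP f u) (A + B) × coeff (mulP f u) (A + B) ≋ coeff f A * coeff u B [mod p ]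
      ih = mulP-leading f u (λ i A<i → f≤1+A (suc i) (s≤s A<i)) u≤B
      B<1+A+B : B < suc (A + B)
      B<1+A+B = s≤s (m≤n+m B A)
      shift : ∀ i → B < suc i → coeff (mulP (a ∷ f) u) (suc i) ≋ coeff (mulP f u) i [mod p ]
      shift i B<1+i = begin
        coeff (mulP (a ∷ f) u) (suc i)            ≈⟨ coeff-mulP-∷-≋ a f u (suc i) ⟩
        a * coeff u (suc i) + coeff (mulP f u) i  ≈⟨ +-congʳ-≋ (coeff (mulP f u) i) (*-zeroʳ-≋ a u≋0) ⟩
        coeff (mulP f u) i                        ∎
        where
          u≋0 : coeff u (suc i) ≋ 0 [mod p ]
          u≋0 = ⟦ u≤B (suc i) B<1+i ⟧
      top : DegreeAtMost p (mulP (a ∷ f) u) (suc A + B)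
      top (suc i) (s≤s A+B<i) =
        ⌊ ≋-trans (shift i (m≤n⇒m≤1+n (≤-trans B<1+A+B A+B<i))) ⟦ proj₁ ih i A+B<i ⟧ ⌋

  zero⊎hasDegree : ∀ f → f ≈ [] [modP p ] ⊎ ∃ (HasDegree p f)
  zero⊎hasDegree []      = inj₁ (λ _ → ⌊ ≋-refl {a = 0} ⌋)
  zero⊎hasDegree (a ∷ f) with zero⊎hasDegree f
  ... | inj₂ (d , lead≢0 , f≤d) = inj₂ (suc d , lead≢0 , λ { (suc i) (s≤s d<i) → f≤d i d<i })
  ... | inj₁ f≈0 with p ∣? ∣ a - 0 ∣
  ...   | yes a≡0 = inj₁ (λ { zero → a≡0 ; (suc i) → f≈0 i })
  ...   | no  a≢0 = inj₂ (0 , a≢0 , λ { (suc i) _ → f≈0 i })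

  hasDegree-unique : ∀ f {d e} → HasDegree p f d → HasDegree p f e → d ≡ e
  hasDegree-unique f {d} {e} (lead-d≢0 , f≤d) (lead-e≢0 , f≤e) with <-cmp d e
  ... | tri< d<e _ _ = contradiction (f≤d e d<e) lead-e≢0
  ... | tri≈ _ d≡e _ = d≡e
  ... | tri> _ _ e<d = contradiction (f≤e d e<d) lead-d≢0

module _ {p : ℕ} (p-prime : Prime p) where

  1≢0-mod : ¬ 1 ≋ 0 [mod p ]
  1≢0-mod 1≋0 = ¬prime[1] (subst Prime (∣1⇒≡1 (≋0⇒∣ 1≋0)) p-prime)

  2≢0-mod : p ≢ 2 → ¬ 2 ≋ 0 [mod p ]
  2≢0-mod p≢2 2≋0 = p≢2 (≤-antisym (∣⇒≤ (≋0⇒∣ 2≋0)) (nonTrivial⇒n>1 p {{prime⇒nonTrivial p-prime}}))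

  *-nonzero-≋ : ∀ {a b} → ¬ a ≋ 0 [mod p ] → ¬ b ≋ 0 [mod p ] → ¬ a * b ≋ 0 [mod p ]
  *-nonzero-≋ {a} {b} a≢0 b≢0 ab≋0 with euclidsLemma a b p-prime (≋0⇒∣ ab≋0)
  ... | inj₁ p∣a = a≢0 (∣⇒≋0 p∣a)
  ... | inj₂ p∣b = b≢0 (∣⇒≋0 p∣b)

  mulP-hasDegree : ∀ f u {A B} → HasDegree p f A → HasDegree p u B → HasDegree p (mulP f u) (A + B)
  mulP-hasDegree f u {A} {B} (f-lead≢0 , f≤A) (u-lead≢0 , u≤B) = lead≢0 , top
    where
      open Σ (mulP-leading f u f≤A u≤B) renaming (proj₁ to top; proj₂ to lead≋)
      lead≢0 : ¬ coeff (mulP f u) (A + B) ≡ 0 [mod p ]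
      lead≢0 lead≡0 = *-nonzero-≋ {coeff f A} {coeff u B} (f-lead≢0 ∘ ⌊_⌋) (u-lead≢0 ∘ ⌊_⌋)
        (≋-trans (≋-sym lead≋) ⟦ lead≡0 ⟧)

  positiveDegree⇒¬IsUnit : ∀ g {A} → HasDegree p g A → 0 < A → ¬ IsUnit p g
  positiveDegree⇒¬IsUnit g {suc A} g-deg _ (u , gu≈1) with zero⊎hasDegree u
  ... | inj₁ u≈0         =
    1≢0-mod (≋-trans {b = coeff (mulP g u) 0} (≋-sym ⟦ gu≈1 0 ⟧) ⟦ mulP-zeroʳ g u u≈0 0 ⟧)
  -- g u has its leading coefficient at the positive index suc A + B, where 1 has none
  ... | inj₂ (B , u-deg) = proj₁ (mulP-hasDegree g u g-deg u-deg) (gu≈1 (suc A + B))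

1+x : Poly
1+x = 1 ∷ 1 ∷ []

coeff-1+x* : ∀ h i → coeff (mulP 1+x h) i ≡ coeff h i + coeff (0 ∷ h) i
coeff-1+x* h zero = begin
  coeff (mulP 1+x h) 0                    ≡⟨ coeff-mulP-∷ 1 (1 ∷ []) h 0 ⟩
  1 * coeff h 0 + 0                       ≡⟨ cong (_+ 0) (*-identityˡ _) ⟩
  coeff h 0 + 0                           ∎
  where open ≡-Reasoning
coeff-1+x* h (suc i) = begin
  coeff (mulP 1+x h) (suc i)              ≡⟨ coeff-mulP-∷ 1 (1 ∷ []) h (suc i) ⟩
  1 * coeff h (suc i) + coeff (mulP (1 ∷ []) h) i
                                          ≡⟨ cong₂ _+_ (*-identityˡ _) (coeff-mulP-∷ 1 [] h i) ⟩
  coeff h (suc i) + (1 * coeff h i + coeff (0 ∷ []) i)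
                                          ≡⟨ cong (λ x → coeff h (suc i) + x) (cong₂ _+_ (*-identityˡ _) (coeff-0∷[] i)) ⟩
  coeff h (suc i) + (coeff h i + 0)       ≡⟨ cong (λ x → coeff h (suc i) + x) (+-identityʳ _) ⟩
  coeff h (suc i) + coeff h i             ∎
  where
    open ≡-Reasoning
    coeff-0∷[] : ∀ j → coeff (0 ∷ []) j ≡ 0
    coeff-0∷[] zero    = refl
    coeff-0∷[] (suc j) = refl

reflect-index : ∀ r j s → suc j + s ≡ r → suc (r + r) ∸ suc s ≡ suc (r + j)
reflect-index r j s 1+j+s≡r = begin
  (r + r) ∸ s              ≡⟨ cong (λ x → (r + x) ∸ s) (sym 1+j+s≡r) ⟩
  (r + (suc j + s)) ∸ s    ≡⟨ cong (_∸ s) (sym (+-assoc r (suc j) s)) ⟩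
  (r + suc j + s) ∸ s      ≡⟨ m+n∸n≡m (r + suc j) s ⟩
  r + suc j                ≡⟨ +-suc r j ⟩
  suc (r + j)              ∎
  where open ≡-Reasoning

-- The coefficients of the power series c / (1 + x) over 𝔽ₚ.
divBy1+x : ℕ → (ℕ → ℕ) → ℕ → ℕ
divBy1+x p c zero    = c 0
divBy1+x p c (suc i) = c (suc i) + neg p (divBy1+x p c i)

module _ {p : ℕ} .{{_ : NonZero p}} where

  divBy1+x-step : ∀ c i → divBy1+x p c (suc i) + divBy1+x p c i ≋ c (suc i) [mod p ]
  divBy1+x-step c i = begin
    (c (suc i) + neg p q) + q  ≡⟨ +-assoc (c (suc i)) (neg p q) q ⟩
    c (suc i) + (neg p q + q)  ≡⟨ cong (λ x → c (suc i) + x) (+-comm (neg p q) q) ⟩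
    c (suc i) + (q + neg p q)  ≈⟨ +-congˡ-≋ (c (suc i)) (+-neg-≋ p q) ⟩
    c (suc i) + 0              ≡⟨ +-identityʳ (c (suc i)) ⟩
    c (suc i)                  ∎
    where
      open SetoidReasoning (≋-setoid p)
      q : ℕ
      q = divBy1+x p c i

  divBy1+x-cong : ∀ c d t → (∀ i → i ≤ t → c i ≋ d i [mod p ]) →
                  divBy1+x p c t ≋ divBy1+x p d t [mod p ]
  divBy1+x-cong c d zero    c≋d = c≋d 0 z≤n
  divBy1+x-cong c d (suc t) c≋d =
    +-cong-≋ (c≋d (suc t) ≤-refl)
             (*-congˡ-≋ (pred p) (divBy1+x-cong c d t (λ i i≤t → c≋d i (m≤n⇒m≤1+n i≤t))))

  -- Dividing from the top is dividing the reversed sequence rev from the bottom.  Both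
  -- quotients obey q (k + 1) + q k ≡ c (k + 1) (with reflected indices for rev) and agree
  -- at the middle index r by symmetry, so walking up to 2r they still agree.
  divBy1+x-palindrome : ∀ c r → (∀ i → i ≤ suc (r + r) → c (suc (r + r) ∸ i) ≋ c i [mod p ]) →
                        divBy1+x p c (r + r) ≋ c (suc (r + r)) [mod p ]
  divBy1+x-palindrome c r palindrome = walk r 0 (+-identityʳ r)
    where
      open SetoidReasoning (≋-setoid p)
      rev : ℕ → ℕ
      rev i = c (suc (r + r) ∸ i)
      walk : ∀ j s → j + s ≡ r → divBy1+x p c (r + j) ≋ divBy1+x p rev s [mod p ]
      walk zero s s≡r = begin
        divBy1+x p c (r + 0)  ≡⟨ cong (divBy1+x p c) (trans (+-identityʳ r) (sym s≡r)) ⟩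
        divBy1+x p c s        ≈⟨ divBy1+x-cong c rev s (λ i i≤s → ≋-sym (palindrome i (≤-trans i≤s s≤m))) ⟩
        divBy1+x p rev s      ∎
        where
          s≤m : s ≤ suc (r + r)
          s≤m = m≤n⇒m≤1+n (≤-trans (≤-reflexive s≡r) (m≤m+n r r))
      walk (suc j) s 1+j+s≡r = +-cancelʳ-≋ (begin
        divBy1+x p c (r + suc j) + divBy1+x p c (r + j)
                   ≡⟨ cong (λ k → divBy1+x p c k + divBy1+x p c (r + j)) (+-suc r j) ⟩
        divBy1+x p c (suc (r + j)) + divBy1+x p c (r + j)
                   ≈⟨ divBy1+x-step c (r + j) ⟩
        c (suc (r + j))
                   ≡⟨ cong c (sym (reflect-index r j s 1+j+s≡r)) ⟩
        rev (suc s)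
                   ≈⟨ ≋-sym (divBy1+x-step rev s) ⟩
        divBy1+x p rev (suc s) + divBy1+x p rev s
                   ≡⟨ +-comm (divBy1+x p rev (suc s)) (divBy1+x p rev s) ⟩
        divBy1+x p rev s + divBy1+x p rev (suc s)
                   ≈⟨ +-congˡ-≋ (divBy1+x p rev s) (≋-sym (walk j (suc s) (trans (+-suc j s) 1+j+s≡r))) ⟩
        divBy1+x p rev s + divBy1+x p c (r + j) ∎)

Palindromic : ℕ → Poly → ℕ → Set
Palindromic p f d = ∀ i → i ≤ d → coeff f (d ∸ i) ≡ coeff f i [mod p ]

quotientBy1+x : ℕ → Poly → ℕ → Poly
quotientBy1+x p f m = map (divBy1+x p (coeff f)) (upTo m)

module _ {p : ℕ} .{{_ : NonZero p}} (f : Poly) (r : ℕ)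
         (f≤m : DegreeAtMost p f (suc (r + r))) (palindrome : Palindromic p f (suc (r + r))) where

  private
    m : ℕ
    m = suc (r + r)
    h : Poly
    h = quotientBy1+x p f m
    q : ℕ → ℕ
    q = divBy1+x p (coeff f)

  quotientBy1+x-last : coeff h (r + r) ≋ coeff f m [mod p ]
  quotientBy1+x-last = ≋-trans (≋-reflexive (coeff-map-applyUpTo-< q id {i = r + r} ≤-refl))
                               (divBy1+x-palindrome (coeff f) r (λ i i≤m → ⟦ palindrome i i≤m ⟧))

  oddPalindrome≈1+x*quotient : f ≈ mulP 1+x h [modP p ]
  oddPalindrome≈1+x*quotient i = ⌊ ≋-trans (coeff≋ i) (≋-reflexive (sym (coeff-1+x* h i))) ⌋
    where
      open SetoidReasoning (≋-setoid p)
      h< : ∀ {i} → i < m → coeff h i ≡ q i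
      h< = coeff-map-applyUpTo-< q id
      h≥ : ∀ {i} → m ≤ i → coeff h i ≡ 0
      h≥ = coeff-map-applyUpTo-≥ q id
      coeff≋ : ∀ i → coeff f i ≋ coeff h i + coeff (0 ∷ h) i [mod p ]
      coeff≋ zero = ≋-reflexive (sym (+-identityʳ (coeff f 0)))
      coeff≋ (suc j) with <-cmp (suc j) m
      ... | tri< 1+j<m _ _ = begin
        coeff f (suc j)           ≈⟨ ≋-sym (divBy1+x-step (coeff f) j) ⟩
        q (suc j) + q j           ≡⟨ sym (cong₂ _+_ (h< 1+j<m) (h< (<⇒≤ 1+j<m))) ⟩
        coeff h (suc j) + coeff h j ∎
      ... | tri≈ _ refl _ = begin
        coeff f m                 ≈⟨ ≋-sym quotientBy1+x-last ⟩
        coeff h (r + r)           ≡⟨ sym (cong₂ _+_ (h≥ ≤-refl) refl) ⟩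
        coeff h m + coeff h (r + r) ∎
      ... | tri> _ _ m<1+j = begin
        coeff f (suc j)           ≈⟨ ⟦ f≤m (suc j) m<1+j ⟧ ⟩
        0                         ≡⟨ sym (cong₂ _+_ (h≥ (<⇒≤ m<1+j)) (h≥ (≤-pred m<1+j))) ⟩
        coeff h (suc j) + coeff h j ∎

  quotientBy1+x-hasDegree : ¬ coeff f m ≡ 0 [mod p ] → HasDegree p h (r + r)
  quotientBy1+x-hasDegree lead≢0 = lead≢0 ∘ h-last≡0⇒ , h≤r+r
    where
      h-last≡0⇒ : coeff h (r + r) ≡ 0 [mod p ] → coeff f m ≡ 0 [mod p ]
      h-last≡0⇒ h-last≡0 = ⌊ ≋-trans (≋-sym quotientBy1+x-last) ⟦ h-last≡0 ⟧ ⌋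
      h≤r+r : DegreeAtMost p h (r + r)
      h≤r+r i r+r<i = ⌊ ≋-reflexive (coeff-map-applyUpTo-≥ q id r+r<i) ⌋

module _ {p : ℕ} (p-prime : Prime p) where

  private instance
    p≢0 : NonZero p
    p≢0 = prime⇒nonZero p-prime

  1+x-hasDegree : HasDegree p 1+x 1
  1+x-hasDegree = 1≢0-mod p-prime ∘ ⟦_⟧ , λ where
    (suc zero)    (s≤s ())
    (suc (suc i)) _ → ⌊ ≋-refl {a = 0} ⌋

  oddSelfReciprocal⇒¬Irreducible : ∀ f {r} → 0 < r →
    HasDegree p f (suc (r + r)) → Palindromic p f (suc (r + r)) → ¬ Irreducible p f
  oddSelfReciprocal⇒¬Irreducible f {r} 0<r (lead≢0 , f≤m) palindrome (_ , _ , factorization) =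
    [ positiveDegree⇒¬IsUnit p-prime 1+x 1+x-hasDegree (s≤s z≤n)
    , positiveDegree⇒¬IsUnit p-prime h h-hasDegree (≤-trans 0<r (m≤m+n r r))
    ] (factorization 1+x h (oddPalindrome≈1+x*quotient f r f≤m palindrome))
    where
      h : Poly
      h = quotientBy1+x p f (suc (r + r))
      h-hasDegree : HasDegree p h (r + r)
      h-hasDegree = quotientBy1+x-hasDegree f r f≤m palindrome lead≢0

coeff-fn0-< : ∀ n {i} → i < suc n → coeff (fn0 n) i ≡ 2 * (n C (2 * i))
coeff-fn0-< n = coeff-map-applyUpTo-< (λ j → 2 * (n C (2 * j))) id

coeff-fn0-vanishes : ∀ n {i} → n < 2 * i → coeff (fn0 n) i ≡ 0
coeff-fn0-vanishes n {i} n<2i with i <? suc n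
... | yes i<1+n = trans (coeff-fn0-< n i<1+n) (cong (2 *_) (k>n⇒nCk≡0 n<2i))
... | no  i≮1+n = coeff-map-applyUpTo-≥ _ id (≮⇒≥ i≮1+n)

fn0-hasDegree : ∀ {p} → Prime p → p ≢ 2 → ∀ m → HasDegree p (fn0 (2 * m)) m
fn0-hasDegree {p} p-prime p≢2 m = lead≢0 , fn0≤m
  where
    lead≡2 : coeff (fn0 (2 * m)) m ≡ 2
    lead≡2 = trans (coeff-fn0-< (2 * m) (s≤s (m≤m+n m _))) (cong (2 *_) (nCn≡1 (2 * m)))
    lead≢0 : ¬ coeff (fn0 (2 * m)) m ≡ 0 [mod p ]
    lead≢0 lead≡0 = 2≢0-mod p-prime p≢2 (≋-trans (≋-sym (≋-reflexive lead≡2)) ⟦ lead≡0 ⟧)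
    fn0≤m : DegreeAtMost p (fn0 (2 * m)) m
    fn0≤m i m<i = ⌊ ≋-reflexive (coeff-fn0-vanishes (2 * m) {i} (*-monoʳ-< 2 m<i)) ⌋

≡2-mod-4⇒≡2*odd : ∀ n → n % 4 ≡ 2 → n ≡ 2 * suc (n / 4 + n / 4)
≡2-mod-4⇒≡2*odd n n%4≡2 = begin
  n                    ≡⟨ m≡m%n+[m/n]*n n 4 ⟩
  n % 4 + n / 4 * 4    ≡⟨ cong (_+ n / 4 * 4) n%4≡2 ⟩
  2 + n / 4 * 4        ≡⟨ regroup (n / 4) ⟩
  2 * suc (n / 4 + n / 4) ∎
  where
    open ≡-Reasoning
    regroup : ∀ q → 2 + q * 4 ≡ 2 * suc (q + q)
    regroup = ℕ-Solver.solve-∀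

corollary3p2 : (p : ℕ) → Prime p → p ≢ 2 → (n : ℕ) → 2 < n → n % 4 ≡ 2 →
    ¬ (Irreducible p (fn0 n) × SelfReciprocal p (fn0 n))
corollary3p2 p p-prime p≢2 n 2<n n%4≡2 (irreducible , d , fn0-deg , palindrome) =
  oddSelfReciprocal⇒¬Irreducible p-prime (fn0 n) 0<r
    (subst (HasDegree p (fn0 n)) d≡m fn0-deg) (subst (Palindromic p (fn0 n)) d≡m palindrome) irreducible
  where
    r : ℕ
    r = n / 4
    n≡2m : n ≡ 2 * suc (r + r)
    n≡2m = ≡2-mod-4⇒≡2*odd n n%4≡2
    0<r : 0 < r
    0<r with r | n≡2m
    ... | zero  | n≡2 = contradiction 2<n (<-irrefl (sym n≡2))
    ... | suc _ | _   = s≤s z≤n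
    d≡m : d ≡ suc (r + r)
    d≡m = hasDegree-unique (fn0 n) fn0-deg
            (subst (λ k → HasDegree p (fn0 k) (suc (r + r))) (sym n≡2m) (fn0-hasDegree p-prime p≢2 _))
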